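{- Let $\mathbf{k}$ be a commutative ring, let $\beta,\alpha\in\mathbf{k}$, and let $n$ be a positive integer. Let $\mathcal{X}=\mathbf{k}[x_{i,j}\mid 1\le i<j\le n]$ and let $\mathcal{J}\subseteq\mathcal{X}$ be the ideal generated by all elements $x_{i,j}x_{j,k}-x_{i,k}(x_{i,j}+x_{j,k}+\beta)-\alpha$ with $1\le i<j<k\le n$. For $1\le j<i\le n$ define $x_{i,j}=-\beta-x_{j,i}\in\mathcal{X}$, and for any three distinct $i,j,k\in\{1,\dots,n\}$ define $$J_{i,j,k}=x_{i,j}x_{j,k}+x_{j,k}x_{k,i}+x_{k,i}x_{i,j}+\beta(x_{i,j}+x_{j,k}+x_{k,i})+\beta^2-\alpha.$$ Then $\mathcal{J}$ is generated by all $J_{i,j,k}$ with $i,j,k$ three distinct elements of $\{1,\dots,n\}$. -}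

module Defs where

open import Level using (Level; _⊔_)
open import Algebra.Bundles using (CommutativeRing)
open import Data.Nat using (ℕ)
open import Data.Fin using (Fin; _<_)
open import Data.Fin.Properties using (<-cmp; <-trans)
open import Data.Product using (Σ; Σ-syntax; _×_; _,_)
open import Relation.Binary.Definitions using (tri<; tri≈; tri>)
open import Relation.Binary.PropositionalEquality using (_≡_; _≢_)

-- The polynomial ring K[V]: realised as the free commutative K-algebra on
-- the variable set V, i.e. ring expressions modulo the least congruence
-- containing the commutative-ring axioms and the ring structure of K on
-- constants.
module Poly {c ℓ} (R : CommutativeRing c ℓ) (V : Set) where
  open CommutativeRing R using (_≈_; _+_; _*_; -_; 0#; 1#) renaming (Carrier to K)

  infixl 6 _⊕_ _⊝_
  infixl 7 _⊗_
  infix 8 ⊖_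
  infix 4 _~_

  data Expr : Set c where
    con : K → Expr
    var : V → Expr
    _⊕_ : Expr → Expr → Expr
    _⊗_ : Expr → Expr → Expr
    ⊖_  : Expr → Expr

  _⊝_ : Expr → Expr → Expr
  p ⊝ q = p ⊕ ⊖ q

  data _~_ : Expr → Expr → Set (c ⊔ ℓ) where
    ~-refl  : ∀ {p} → p ~ p
    ~-sym   : ∀ {p q} → p ~ q → q ~ p
    ~-trans : ∀ {p q r} → p ~ q → q ~ r → p ~ r
    ⊕-cong  : ∀ {p p′ q q′} → p ~ p′ → q ~ q′ → p ⊕ q ~ p′ ⊕ q′
    ⊗-cong  : ∀ {p p′ q q′} → p ~ p′ → q ~ q′ → p ⊗ q ~ p′ ⊗ q′
    ⊖-cong  : ∀ {p p′} → p ~ p′ → ⊖ p ~ ⊖ p′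
    ⊕-assoc : ∀ p q r → (p ⊕ q) ⊕ r ~ p ⊕ (q ⊕ r)
    ⊕-comm  : ∀ p q → p ⊕ q ~ q ⊕ p
    ⊕-idˡ   : ∀ p → con 0# ⊕ p ~ p
    ⊖-invˡ  : ∀ p → ⊖ p ⊕ p ~ con 0#
    ⊗-assoc : ∀ p q r → (p ⊗ q) ⊗ r ~ p ⊗ (q ⊗ r)
    ⊗-comm  : ∀ p q → p ⊗ q ~ q ⊗ p
    ⊗-idˡ   : ∀ p → con 1# ⊗ p ~ p
    distribˡ : ∀ p q r → p ⊗ (q ⊕ r) ~ (p ⊗ q) ⊕ (p ⊗ r)
    con-≈   : ∀ {a b} → a ≈ b → con a ~ con b
    con-+   : ∀ a b → con (a + b) ~ con a ⊕ con b
    con-*   : ∀ a b → con (a * b) ~ con a ⊗ con b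
    con-neg : ∀ a → con (- a) ~ ⊖ con a

  data InIdeal (G : Expr → Set c) : Expr → Set (c ⊔ ℓ) where
    gen  : ∀ {f} → G f → InIdeal G f
    zero : InIdeal G (con 0#)
    add  : ∀ {f g} → InIdeal G f → InIdeal G g → InIdeal G (f ⊕ g)
    mul  : ∀ {f} (r : Expr) → InIdeal G f → InIdeal G (r ⊗ f)
    resp : ∀ {f g} → f ~ g → InIdeal G f → InIdeal G g

  SameIdeal : (G H : Expr → Set c) → Set (c ⊔ ℓ)
  SameIdeal G H = ∀ f → (InIdeal G f → InIdeal H f) × (InIdeal H f → InIdeal G f)

Var : ℕ → Set
Var n = Σ[ i ∈ Fin n ] Σ[ j ∈ Fin n ] i < j

module Setup {c ℓ} (R : CommutativeRing c ℓ) (β α : CommutativeRing.Carrier R) (n : ℕ) where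
  open CommutativeRing R using (0#)
  open Poly R (Var n) public

  -- x_{i,j} for arbitrary i ≠ j; x_{i,j} = -β - x_{j,i} when j < i.
  -- (The diagonal value is junk and never used.)
  xx : Fin n → Fin n → Expr
  xx i j with <-cmp i j
  ... | tri< i<j _ _ = var (i , j , i<j)
  ... | tri≈ _ _ _   = con 0#
  ... | tri> _ _ j<i = ⊖ con β ⊝ var (j , i , j<i)

  OrigGen : Expr → Set c
  OrigGen f = Σ[ i ∈ Fin n ] Σ[ j ∈ Fin n ] Σ[ k ∈ Fin n ] Σ[ p ∈ i < j ] Σ[ q ∈ j < k ]
    (f ≡ var (i , j , p) ⊗ var (j , k , q)
         ⊝ var (i , k , <-trans p q) ⊗ (var (i , j , p) ⊕ var (j , k , q) ⊕ con β)
         ⊝ con α)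

  J : Fin n → Fin n → Fin n → Expr
  J i j k = xx i j ⊗ xx j k ⊕ xx j k ⊗ xx k i ⊕ xx k i ⊗ xx i j
          ⊕ con β ⊗ (xx i j ⊕ xx j k ⊕ xx k i)
          ⊕ con β ⊗ con β ⊝ con α

  JGen : Expr → Set c
  JGen f = Σ[ i ∈ Fin n ] Σ[ j ∈ Fin n ] Σ[ k ∈ Fin n ]
    (i ≢ j × j ≢ k × i ≢ k × f ≡ J i j k)

-- The polynomial J_{i,j,k} is invariant under rotating (i, j, k)
-- and, by a ring identity, under reversing it, so every J_{i,j,k} with distinct indices equals
-- some J_{a,b,c} with a < b < c. Substituting x_{c,a} = -β - x_{a,c} turns J_{a,b,c} into
-- exactly the generator x_{a,b} x_{b,c} - x_{a,c} (x_{a,b} + x_{b,c} + β) - α of 𝒥.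
module Submission where

open import Level using (Level; _⊔_)
open import Algebra.Bundles using (CommutativeRing)
open import Algebra.Bundles.Raw using (RawRing)
open import Algebra.Structures using (IsCommutativeRing)
open import Data.Nat as ℕ using (ℕ; zero; suc; _≤_)
import Data.Nat.Properties as ℕ
open import Data.Integer as ℤ using (ℤ; +_; -[1+_]; _⊖_)
import Data.Integer.Properties as ℤ
open import Data.Fin using (_<_)
open import Data.Fin.Properties using (<-cmp; <-trans; <-irrelevant; <⇒≢)
open import Data.Maybe using (Maybe; just; nothing)
open import Data.Product using (_,_)
open import Data.Empty using (⊥-elim)
open import Relation.Nullary using (yes; no)
open import Relation.Binary.Definitions using (Tri; tri<; tri≈; tri>)
open import Relation.Binary.Bundles using (Setoid)
open import Relation.Binary.PropositionalEquality as ≡ using (_≡_; _≢_; ≢-sym)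
import Algebra.Solver.Ring
import Algebra.Solver.Ring.AlmostCommutativeRing as ACR
open import Defs

-- The identities below need cancellation of integer coefficients, so the ring solver is run with
-- ℤ as coefficient ring, mapped into K.
module IntegerCoefficients {c ℓ} (K : CommutativeRing c ℓ) where
  open CommutativeRing K
  open import Algebra.Properties.Ring ring using (-0#≈0#; -‿involutive; -‿distribˡ-*; -‿distribʳ-*)
  open import Algebra.Properties.AbelianGroup +-abelianGroup using (⁻¹-∙-comm; xyx⁻¹≈y)
  open import Algebra.Properties.Semiring.Mult semiring using (_×_; ×-homo-+; ×1-homo-*)
  open import Relation.Binary.Reasoning.Setoid setoid

  fromℤ : ℤ → Carrier
  fromℤ (+ n)    = n × 1#
  fromℤ -[1+ n ] = - (suc n × 1#)

  fromℤ-neg : ∀ i → fromℤ (ℤ.- i) ≈ - fromℤ i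
  fromℤ-neg (+ zero)  = sym -0#≈0#
  fromℤ-neg (+ suc n) = refl
  fromℤ-neg -[1+ n ]  = sym (-‿involutive _)

  +-cancelˡ-− : ∀ x a b → (x + a) - (x + b) ≈ a - b
  +-cancelˡ-− x a b = begin
    (x + a) - (x + b)       ≈⟨ +-congˡ (⁻¹-∙-comm x b) ⟨
    (x + a) + (- x + - b)   ≈⟨ +-assoc _ _ _ ⟨
    ((x + a) - x) + - b     ≈⟨ +-congʳ (xyx⁻¹≈y x a) ⟩
    a - b                   ∎

  fromℤ-⊖ : ∀ m n → fromℤ (m ⊖ n) ≈ m × 1# - n × 1#
  fromℤ-⊖ zero    zero    = sym (-‿inverseʳ 0#)
  fromℤ-⊖ zero    (suc n) = sym (+-identityˡ _)
  fromℤ-⊖ (suc m) zero    = sym (trans (+-congˡ -0#≈0#) (+-identityʳ _))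
  fromℤ-⊖ (suc m) (suc n) = begin
    fromℤ (suc m ⊖ suc n)     ≡⟨ ≡.cong fromℤ (ℤ.[1+m]⊖[1+n]≡m⊖n m n) ⟩
    fromℤ (m ⊖ n)             ≈⟨ fromℤ-⊖ m n ⟩
    m × 1# - n × 1#           ≈⟨ +-cancelˡ-− 1# _ _ ⟨
    suc m × 1# - suc n × 1#   ∎

  fromℤ-+ : ∀ i j → fromℤ (i ℤ.+ j) ≈ fromℤ i + fromℤ j
  fromℤ-+ (+ m)    (+ n)    = ×-homo-+ 1# m n
  fromℤ-+ (+ m)    -[1+ n ] = fromℤ-⊖ m (suc n)
  fromℤ-+ -[1+ m ] (+ n)    = trans (fromℤ-⊖ n (suc m)) (+-comm _ _)
  fromℤ-+ -[1+ m ] -[1+ n ] = begin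
    - (suc (suc (m ℕ.+ n)) × 1#)      ≡⟨ ≡.cong (λ k → - (suc k × 1#)) (ℕ.+-suc m n) ⟨
    - ((suc m ℕ.+ suc n) × 1#)        ≈⟨ -‿cong (×-homo-+ 1# (suc m) (suc n)) ⟩
    - (suc m × 1# + suc n × 1#)       ≈⟨ ⁻¹-∙-comm _ _ ⟨
    - (suc m × 1#) + - (suc n × 1#)   ∎

  fromℤ-*-pos : ∀ m j → fromℤ (+ m ℤ.* j) ≈ m × 1# * fromℤ j
  fromℤ-*-pos m (+ n) = begin
    fromℤ (+ m ℤ.* + n)               ≡⟨ ≡.cong fromℤ (ℤ.pos-* m n) ⟨
    (m ℕ.* n) × 1#                    ≈⟨ ×1-homo-* m n ⟩
    m × 1# * n × 1#                   ∎
  fromℤ-*-pos m -[1+ n ] = begin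
    fromℤ (+ m ℤ.* -[1+ n ])          ≡⟨ ≡.cong fromℤ (ℤ.neg-distribʳ-* (+ m) (+ suc n)) ⟨
    fromℤ (ℤ.- (+ m ℤ.* + suc n))     ≈⟨ fromℤ-neg (+ m ℤ.* + suc n) ⟩
    - fromℤ (+ m ℤ.* + suc n)         ≈⟨ -‿cong (fromℤ-*-pos m (+ suc n)) ⟩
    - (m × 1# * suc n × 1#)           ≈⟨ -‿distribʳ-* _ _ ⟩
    m × 1# * - (suc n × 1#)           ∎

  fromℤ-* : ∀ i j → fromℤ (i ℤ.* j) ≈ fromℤ i * fromℤ j
  fromℤ-* (+ m)    j = fromℤ-*-pos m j
  fromℤ-* -[1+ m ] j = begin
    fromℤ (-[1+ m ] ℤ.* j)            ≡⟨ ≡.cong fromℤ (ℤ.neg-distribˡ-* (+ suc m) j) ⟨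
    fromℤ (ℤ.- (+ suc m ℤ.* j))       ≈⟨ fromℤ-neg (+ suc m ℤ.* j) ⟩
    - fromℤ (+ suc m ℤ.* j)           ≈⟨ -‿cong (fromℤ-*-pos (suc m) j) ⟩
    - (suc m × 1# * fromℤ j)          ≈⟨ -‿distribˡ-* _ _ ⟩
    - (suc m × 1#) * fromℤ j          ∎

  fromℤ-homomorphism : ℤ.+-*-rawRing ACR.-Raw-AlmostCommutative⟶ ACR.fromCommutativeRing K
  fromℤ-homomorphism = record
    { ⟦_⟧    = fromℤ
    ; +-homo = fromℤ-+
    ; *-homo = fromℤ-*
    ; -‿homo = fromℤ-neg
    ; 0-homo = refl
    ; 1-homo = +-identityʳ 1#
    }

  fromℤ-≟ : ∀ i j → Maybe (fromℤ i ≈ fromℤ j)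
  fromℤ-≟ i j with i ℤ.≟ j
  ... | yes ≡.refl = just refl
  ... | no  _      = nothing

  open Algebra.Solver.Ring ℤ.+-*-rawRing (ACR.fromCommutativeRing K) fromℤ-homomorphism fromℤ-≟ public

-- For x = x_{i,j}, y = x_{j,k}, z = x_{k,i}: opp x is x_{j,i} and J₃ x y z is J_{i,j,k};
-- G₃ x y z is the generator of 𝒥 for i < j < k when z = x_{i,k}.
module TriangleForms {c ℓ} (R : RawRing c ℓ) (β α : RawRing.Carrier R) where
  open RawRing R

  opp : Carrier → Carrier
  opp x = - β + - x

  J₃ : Carrier → Carrier → Carrier → Carrier
  J₃ x y z = x * y + y * z + z * x + β * (x + y + z) + β * β + - α

  G₃ : Carrier → Carrier → Carrier → Carrier
  G₃ x y z = x * y + - (z * (x + y + β)) + - α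

module TriangleIdentities {c ℓ} (K : CommutativeRing c ℓ) (β α : CommutativeRing.Carrier K) where
  open CommutativeRing K
  open TriangleForms rawRing β α public
  private
    module S = IntegerCoefficients K

    polynomialSyntax : ℕ → RawRing Level.zero Level.zero
    polynomialSyntax n = record
      { Carrier = S.Polynomial n ; _≈_ = _≡_
      ; _+_ = S._:+_ ; _*_ = S._:*_ ; -_ = S.:-_ ; 0# = S.con (+ 0) ; 1# = S.con (+ 1) }

    module F (n : ℕ) = TriangleForms (polynomialSyntax n)

  J₃-rotate : ∀ x y z → J₃ x y z ≈ J₃ y z x
  J₃-rotate = S.solve 5 (λ b a x y z → F.J₃ 5 b a x y z S.:= F.J₃ 5 b a y z x) refl β α

  J₃-reverse : ∀ x y z → J₃ (opp y) (opp x) (opp z) ≈ J₃ x y z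
  J₃-reverse = S.solve 5 (λ b a x y z →
    F.J₃ 5 b a (F.opp 5 b a y) (F.opp 5 b a x) (F.opp 5 b a z) S.:= F.J₃ 5 b a x y z) refl β α

  J₃-opp : ∀ x y z → J₃ x y (opp z) ≈ G₃ x y z
  J₃-opp = S.solve 5 (λ b a x y z → F.J₃ 5 b a x y (F.opp 5 b a z) S.:= F.G₃ 5 b a x y z) refl β α

  opp-involutive : ∀ x → opp (opp x) ≈ x
  opp-involutive = S.solve 3 (λ b a x → F.opp 3 b a (F.opp 3 b a x) S.:= x) refl β α

  J₃-cong : ∀ {x x′ y y′ z z′} → x ≈ x′ → y ≈ y′ → z ≈ z′ → J₃ x y z ≈ J₃ x′ y′ z′
  J₃-cong x≈ y≈ z≈ = +-congʳ (+-congʳ (+-cong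
    (+-cong (+-cong (*-cong x≈ y≈) (*-cong y≈ z≈)) (*-cong z≈ x≈))
    (*-congˡ (+-cong (+-cong x≈ y≈) z≈))))

module PolynomialRing {c ℓ} (R : CommutativeRing c ℓ) (V : Set) where
  open CommutativeRing R using (0#; 1#)
  open Poly R V

  ~-setoid : Setoid c (c ⊔ ℓ)
  ~-setoid = record
    { _≈_ = _~_ ; isEquivalence = record { refl = ~-refl ; sym = ~-sym ; trans = ~-trans } }

  open import Algebra.Consequences.Setoid ~-setoid
    using (comm∧idˡ⇒id; comm∧invˡ⇒inv; comm∧distrˡ⇒distr)

  isCommutativeRing : IsCommutativeRing _~_ _⊕_ _⊗_ ⊖_ (con 0#) (con 1#)
  isCommutativeRing = record
    { isRing = record
      { +-isAbelianGroup = record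
        { isGroup = record
          { isMonoid = record
            { isSemigroup = record
              { isMagma = record { isEquivalence = Setoid.isEquivalence ~-setoid ; ∙-cong = ⊕-cong }
              ; assoc = ⊕-assoc }
            ; identity = comm∧idˡ⇒id ⊕-comm ⊕-idˡ }
          ; inverse = comm∧invˡ⇒inv ⊕-comm ⊖-invˡ
          ; ⁻¹-cong = ⊖-cong }
        ; comm = ⊕-comm }
      ; *-cong = ⊗-cong
      ; *-assoc = ⊗-assoc
      ; *-identity = comm∧idˡ⇒id ⊗-comm ⊗-idˡ
      ; distrib = comm∧distrˡ⇒distr ⊕-cong ⊗-comm distribˡ }
    ; *-comm = ⊗-comm }

  commutativeRing : CommutativeRing c (c ⊔ ℓ)
  commutativeRing = record { isCommutativeRing = isCommutativeRing }

  InIdeal-least : ∀ {G H} → (∀ {f} → G f → InIdeal H f) → ∀ {f} → InIdeal G f → InIdeal H f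
  InIdeal-least G⊆H (gen g)    = G⊆H g
  InIdeal-least G⊆H zero       = zero
  InIdeal-least G⊆H (add f g)  = add (InIdeal-least G⊆H f) (InIdeal-least G⊆H g)
  InIdeal-least G⊆H (mul r f)  = mul r (InIdeal-least G⊆H f)
  InIdeal-least G⊆H (resp e f) = resp e (InIdeal-least G⊆H f)

  SameIdeal-intro : ∀ {G H} → (∀ {f} → G f → InIdeal H f) → (∀ {f} → H f → InIdeal G f) →
                    SameIdeal G H
  SameIdeal-intro G⊆H H⊆G f = InIdeal-least G⊆H , InIdeal-least H⊆G

module Generators {c ℓ} (R : CommutativeRing c ℓ) (β α : CommutativeRing.Carrier R) (n : ℕ) where
  open Setup R β α n
  open PolynomialRing R (Var n)
  open CommutativeRing commutativeRing using (reflexive; sym; trans)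
  open TriangleIdentities commutativeRing (con β) (con α)

  xx-< : ∀ {i j} (i<j : i < j) → xx i j ≡ var (i , j , i<j)
  xx-< {i} {j} i<j with <-cmp i j
  ... | tri< i<j′ _ _ = ≡.cong (λ p → var (i , j , p)) (<-irrelevant i<j′ i<j)
  ... | tri≈ i≮j _ _  = ⊥-elim (i≮j i<j)
  ... | tri> i≮j _ _  = ⊥-elim (i≮j i<j)

  xx-> : ∀ {i j} (j<i : j < i) → xx i j ≡ opp (var (j , i , j<i))
  xx-> {i} {j} j<i with <-cmp i j
  ... | tri< _ _ j≮i  = ⊥-elim (j≮i j<i)
  ... | tri≈ _ _ j≮i  = ⊥-elim (j≮i j<i)
  ... | tri> _ _ j<i′ = ≡.cong (λ p → opp (var (j , i , p))) (<-irrelevant j<i′ j<i)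

  xx-swap : ∀ {i j} → i ≢ j → xx j i ~ opp (xx i j)
  xx-swap {i} {j} i≢j = swap (<-cmp i j)
    where
    open import Relation.Binary.Reasoning.Setoid ~-setoid

    swap : Tri (i < j) (i ≡ j) (j < i) → xx j i ~ opp (xx i j)
    swap (tri< i<j _ _) = reflexive (≡.trans (xx-> i<j) (≡.cong opp (≡.sym (xx-< i<j))))
    swap (tri≈ _ i≡j _) = ⊥-elim (i≢j i≡j)
    swap (tri> _ _ j<i) = begin
      xx j i                          ≡⟨ xx-< j<i ⟩
      var (j , i , j<i)               ≈⟨ opp-involutive _ ⟨
      opp (opp (var (j , i , j<i)))   ≡⟨ ≡.cong opp (xx-> j<i) ⟨
      opp (xx i j)                    ∎

  J-rotate : ∀ i j k → J i j k ~ J j k i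
  J-rotate i j k = J₃-rotate _ _ _

  J-reverse : ∀ {i j k} → i ≢ j → j ≢ k → k ≢ i → J k j i ~ J i j k
  J-reverse i≢j j≢k k≢i =
    trans (J₃-cong (xx-swap j≢k) (xx-swap i≢j) (xx-swap k≢i)) (J₃-reverse _ _ _)

  J-increasing : ∀ {i j k} (i<j : i < j) (j<k : j < k) →
    J i j k ~ G₃ (var (i , j , i<j)) (var (j , k , j<k)) (var (i , k , <-trans i<j j<k))
  J-increasing i<j j<k =
    trans (J₃-cong (reflexive (xx-< i<j)) (reflexive (xx-< j<k))
                   (reflexive (xx-> (<-trans i<j j<k))))
          (J₃-opp _ _ _)

  OrigGen⊆⟨JGen⟩ : ∀ {f} → OrigGen f → InIdeal JGen f
  OrigGen⊆⟨JGen⟩ (i , j , k , i<j , j<k , ≡.refl) =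
    resp (J-increasing i<j j<k)
         (gen (i , j , k , <⇒≢ i<j , <⇒≢ j<k , <⇒≢ (<-trans i<j j<k) , ≡.refl))

  J-increasing∈⟨OrigGen⟩ : ∀ {i j k} → i < j → j < k → InIdeal OrigGen (J i j k)
  J-increasing∈⟨OrigGen⟩ {i} {j} {k} i<j j<k =
    resp (sym (J-increasing i<j j<k)) (gen (i , j , k , i<j , j<k , ≡.refl))

  J-decreasing∈⟨OrigGen⟩ : ∀ {i j k} → i < j → j < k → InIdeal OrigGen (J k j i)
  J-decreasing∈⟨OrigGen⟩ i<j j<k =
    resp (sym (J-reverse (<⇒≢ i<j) (<⇒≢ j<k) (≢-sym (<⇒≢ (<-trans i<j j<k)))))
         (J-increasing∈⟨OrigGen⟩ i<j j<k)

  J-rotate∈ : ∀ {G i j k} → InIdeal G (J i j k) → InIdeal G (J j k i)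
  J-rotate∈ {i = i} {j} {k} = resp (J-rotate i j k)

  J∈⟨OrigGen⟩ : ∀ {i j k} → i ≢ j → j ≢ k → i ≢ k → InIdeal OrigGen (J i j k)
  J∈⟨OrigGen⟩ {i} {j} {k} i≢j j≢k i≢k = sort (<-cmp i j) (<-cmp j k) (<-cmp i k)
    where
    sort : Tri (i < j) (i ≡ j) (j < i) → Tri (j < k) (j ≡ k) (k < j) → Tri (i < k) (i ≡ k) (k < i) →
           InIdeal OrigGen (J i j k)
    sort (tri≈ _ i≡j _) _              _              = ⊥-elim (i≢j i≡j)
    sort _              (tri≈ _ j≡k _) _              = ⊥-elim (j≢k j≡k)
    sort _              _              (tri≈ _ i≡k _) = ⊥-elim (i≢k i≡k)
    sort (tri< i<j _ _) (tri< j<k _ _) _              = J-increasing∈⟨OrigGen⟩ i<j j<k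
    sort (tri< _ _ _)   (tri> _ _ k<j) (tri< i<k _ _) = J-rotate∈ (J-rotate∈ (J-decreasing∈⟨OrigGen⟩ i<k k<j))
    sort (tri< i<j _ _) (tri> _ _ _)   (tri> _ _ k<i) = J-rotate∈ (J-increasing∈⟨OrigGen⟩ k<i i<j)
    sort (tri> _ _ j<i) (tri< _ _ _)   (tri< i<k _ _) = J-rotate∈ (J-decreasing∈⟨OrigGen⟩ j<i i<k)
    sort (tri> _ _ _)   (tri< j<k _ _) (tri> _ _ k<i) = J-rotate∈ (J-rotate∈ (J-increasing∈⟨OrigGen⟩ j<k k<i))
    sort (tri> _ _ j<i) (tri> _ _ k<j) _              = J-decreasing∈⟨OrigGen⟩ k<j j<i

  JGen⊆⟨OrigGen⟩ : ∀ {f} → JGen f → InIdeal OrigGen f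
  JGen⊆⟨OrigGen⟩ (i , j , k , i≢j , j≢k , i≢k , ≡.refl) = J∈⟨OrigGen⟩ i≢j j≢k i≢k

proposition3p20 : ∀ {c ℓ : Level} (R : CommutativeRing c ℓ) (β α : CommutativeRing.Carrier R) (n : ℕ) → 1 ≤ n →
    Setup.SameIdeal R β α n (Setup.OrigGen R β α n) (Setup.JGen R β α n)
proposition3p20 R β α n _ = SameIdeal-intro OrigGen⊆⟨JGen⟩ JGen⊆⟨OrigGen⟩
  where
  open PolynomialRing R (Var n)
  open Generators R β α n
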